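{- For $\mu\in(0,1)$ consider the Markov chain $(\sigma_j)_{j\ge0}$ on $\{0,1\}$ with $\sigma_0=0$ and $P(0\to1)=P(1\to0)=(1-\mu)/2$. Define the marginal dispersion \[d_m=\frac{\mathrm{Var}(\sigma_m)+2\sum_{j=1}^{m-1}\mathrm{Cov}(\sigma_j,\sigma_m)}{\mathrm E[\sigma_m]}\quad(m\ge1).\] Then $d_m=D_\infty(\mu)\,(1-\mu^m)$, where $D_\infty(\mu)=\dfrac{1+\mu}{2(1-\mu)}$.
   Context: This is the state chain of a symmetric stateful digit-wise operation ($|\mathrm{GEN}|=|\mathrm{KILL}|$, $\mu=|\mathrm{PROP}|/N$) with uniformly random symbols started at $0$.
   Formalization: The parameter μ of the chain ranges only over the rationals in (0,1). -}

module Defs where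

open import Data.Nat as ℕ using (ℕ; zero; suc; _∸_)
open import Data.Fin using (Fin; zero; suc)
open import Data.Rational using (ℚ; 0ℚ; 1ℚ; ½; _+_; _-_; _*_; _÷_; NonZero)

_^ᵠ_ : ℚ → ℕ → ℚ
q ^ᵠ zero  = 1ℚ
q ^ᵠ suc n = q * (q ^ᵠ n)

Σ₁ : ℕ → (ℕ → ℚ) → ℚ
Σ₁ zero    f = 0ℚ
Σ₁ (suc n) f = Σ₁ n f + f (suc n)

Σ₂ : (Fin 2 → ℚ) → ℚ
Σ₂ f = f zero + f (suc zero)

val : Fin 2 → ℚ
val zero = 0ℚ
val (suc zero) = 1ℚ

T : ℚ → Fin 2 → Fin 2 → ℚ
T μ zero       zero       = ½ * (1ℚ + μ)
T μ zero       (suc zero) = ½ * (1ℚ - μ)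
T μ (suc zero) zero       = ½ * (1ℚ - μ)
T μ (suc zero) (suc zero) = ½ * (1ℚ + μ)

Tⁿ : ℚ → ℕ → Fin 2 → Fin 2 → ℚ
Tⁿ μ zero zero       zero       = 1ℚ
Tⁿ μ zero zero       (suc zero) = 0ℚ
Tⁿ μ zero (suc zero) zero       = 0ℚ
Tⁿ μ zero (suc zero) (suc zero) = 1ℚ
Tⁿ μ (suc n) a b = Σ₂ (λ c → Tⁿ μ n a c * T μ c b)

law : ℚ → ℕ → Fin 2 → ℚ
law μ j a = Tⁿ μ j zero a

-- Joint law P(σ_j = a, σ_m = b) for j ≤ m (Markov property).
joint : ℚ → ℕ → ℕ → Fin 2 → Fin 2 → ℚ
joint μ j m a b = Tⁿ μ j zero a * Tⁿ μ (m ∸ j) a b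

mean : ℚ → ℕ → ℚ
mean μ m = Σ₂ (λ a → law μ m a * val a)

cov : ℚ → ℕ → ℕ → ℚ
cov μ j m = Σ₂ (λ a → Σ₂ (λ b → joint μ j m a b * (val a * val b)))
            - mean μ j * mean μ m

var : ℚ → ℕ → ℚ
var μ m = cov μ m m

dispNum : ℚ → ℕ → ℚ
dispNum μ m = var μ m + (1ℚ + 1ℚ) * Σ₁ (m ∸ 1) (λ j → cov μ j m)

dispersion : (μ : ℚ) (m : ℕ) → .{{_ : NonZero (mean μ m)}} → ℚ
dispersion μ m = dispNum μ m ÷ mean μ m

Dinf : (μ : ℚ) → .{{_ : NonZero ((1ℚ + 1ℚ) * (1ℚ - μ))}} → ℚ
Dinf μ = (1ℚ + μ) ÷ ((1ℚ + 1ℚ) * (1ℚ - μ))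

{-# OPTIONS --safe #-}
module Submission where

-- T p has ½(1 + p) on the diagonal and ½(1 - p) off it, and T p · T q = T (q p); so the n-step
-- matrix is T (μⁿ), whence E σ_m = ½(1 - μᵐ) and Cov(σ_j, σ_m) = ¼(μ^(m-j) - μ^(m+j)).
-- Reversing the sum Σ_{0<j<m} μ^(m-j) turns the numerator of d_m into
-- ¼(1 - μ^2m) + ½(1 - μᵐ) Σ_{0<j<m} μʲ, and the geometric series gives
-- 2(1 - μ) · numerator = (1 + μ)(1 - μᵐ) · E σ_m.

open import Defs
open import Data.Nat using (ℕ; _≥_)
open import Data.Rational using (ℚ; 0ℚ; 1ℚ; _<_; _-_; _+_; _*_; NonZero)
open import Data.Product using (Σ; _×_; _,_)
open import Relation.Binary.PropositionalEquality using (_≡_)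

open import Algebra.Bundles using (CommutativeMonoid)
open import Data.Fin using (Fin; zero; suc)
open import Data.Nat as ℕ using (zero; suc; _∸_)
open import Data.Nat.Properties using (≤-refl; m≤n⇒m≤1+n; m+[n∸m]≡n; +-∸-assoc; m+n∸n≡m; n∸n≡0)
open import Data.Rational using (½; _÷_; _≤_; Positive; positive; nonNegative)
open import Data.Rational.Properties
  using ( *-1-commutativeMonoid
        ; +-comm; +-assoc; +-identityˡ; *-assoc; *-identityˡ; *-identityʳ; *-zeroʳ
        ; *-distribˡ-+; *-inverseʳ
        ; <⇒≤; ≤-<-trans; <-respˡ-≡; +-monoʳ-<; neg-antimono-<
        ; *-monoˡ-≤-nonNeg; pos*pos⇒pos; pos⇒nonZero )
open import Data.Rational.Solver using (module +-*-Solver)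
open import Function using (_∘_)
open import Relation.Binary.PropositionalEquality using (refl; sym; trans; cong; cong₂; subst; module ≡-Reasoning)
open import Algebra.Properties.CommutativeSemigroup
  (CommutativeMonoid.commutativeSemigroup *-1-commutativeMonoid) using (xy∙z≈xz∙y)

open +-*-Solver using (solve; _:+_; _:*_; _:-_; con; _:=_)
open ≡-Reasoning

1ᶠ : Fin 2
1ᶠ = suc zero

^ᵠ-+ : ∀ q j k → q ^ᵠ (j ℕ.+ k) ≡ q ^ᵠ j * q ^ᵠ k
^ᵠ-+ q zero    k = sym (*-identityˡ (q ^ᵠ k))
^ᵠ-+ q (suc j) k = trans (cong (q *_) (^ᵠ-+ q j k)) (sym (*-assoc q (q ^ᵠ j) (q ^ᵠ k)))

^ᵠ-suc-<1 : ∀ {q} → 0ℚ ≤ q → q < 1ℚ → ∀ n → q ^ᵠ suc n < 1ℚ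
^ᵠ-suc-<1 {q} 0≤q q<1 zero    = <-respˡ-≡ (sym (*-identityʳ q)) q<1
^ᵠ-suc-<1 {q} 0≤q q<1 (suc n) = ≤-<-trans q*r≤q q<1
  where
  q*r≤q : q * q ^ᵠ suc n ≤ q
  q*r≤q = subst (q * q ^ᵠ suc n ≤_) (*-identityʳ q)
            (*-monoˡ-≤-nonNeg q {{nonNegative 0≤q}} (<⇒≤ (^ᵠ-suc-<1 0≤q q<1 n)))

1-p-positive : ∀ {p} → p < 1ℚ → Positive (1ℚ - p)
1-p-positive p<1 = positive (+-monoʳ-< 1ℚ (neg-antimono-< p<1))

*[1-p]-nonZero : ∀ c .{{_ : Positive c}} {p} → p < 1ℚ → NonZero (c * (1ℚ - p))
*[1-p]-nonZero c {p} p<1 = pos⇒nonZero (c * (1ℚ - p)) {{pos*pos⇒pos c (1ℚ - p) {{1-p-positive p<1}}}}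

÷-cross : ∀ x y z w .{{_ : NonZero y}} .{{_ : NonZero w}} → x * w ≡ z * y → x ÷ y ≡ z ÷ w
÷-cross x y z w xw≡zy = cross (*-inverseʳ y) (*-inverseʳ w)
  where
  cross : ∀ {u v} → y * u ≡ 1ℚ → w * v ≡ 1ℚ → x * u ≡ z * v
  cross {u} {v} yu≡1 wv≡1 = begin
    x * u             ≡⟨ *-identityʳ (x * u) ⟨
    x * u * 1ℚ        ≡⟨ cong (x * u *_) wv≡1 ⟨
    x * u * (w * v)   ≡⟨ solve 4 (λ x u w v → x :* u :* (w :* v) := x :* w :* (u :* v)) refl x u w v ⟩
    x * w * (u * v)   ≡⟨ cong (_* (u * v)) xw≡zy ⟩
    z * y * (u * v)   ≡⟨ solve 4 (λ z y u v → z :* y :* (u :* v) := z :* v :* (y :* u)) refl z y u v ⟩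
    z * v * (y * u)   ≡⟨ cong (z * v *_) yu≡1 ⟩
    z * v * 1ℚ        ≡⟨ *-identityʳ (z * v) ⟩
    z * v             ∎

Σ₁-cong : ∀ n {f g : ℕ → ℚ} → (∀ {j} → j ℕ.≤ n → f j ≡ g j) → Σ₁ n f ≡ Σ₁ n g
Σ₁-cong zero    f≗g = refl
Σ₁-cong (suc n) f≗g = cong₂ _+_ (Σ₁-cong n (f≗g ∘ m≤n⇒m≤1+n)) (f≗g ≤-refl)

Σ₁-distribˡ : ∀ c n f → Σ₁ n (λ j → c * f j) ≡ c * Σ₁ n f
Σ₁-distribˡ c zero    f = sym (*-zeroʳ c)
Σ₁-distribˡ c (suc n) f = trans (cong (_+ c * f (suc n)) (Σ₁-distribˡ c n f))
                                (sym (*-distribˡ-+ c (Σ₁ n f) (f (suc n))))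

Σ₁-sub : ∀ n f g → Σ₁ n (λ j → f j - g j) ≡ Σ₁ n f - Σ₁ n g
Σ₁-sub zero    f g = refl
Σ₁-sub (suc n) f g = trans (cong (_+ (f (suc n) - g (suc n))) (Σ₁-sub n f g))
  (solve 4 (λ F G x y → F :- G :+ (x :- y) := F :+ x :- (G :+ y)) refl
     (Σ₁ n f) (Σ₁ n g) (f (suc n)) (g (suc n)))

Σ₁-suc : ∀ n f → Σ₁ (suc n) f ≡ f 1 + Σ₁ n (f ∘ suc)
Σ₁-suc zero    f = +-comm 0ℚ (f 1)
Σ₁-suc (suc n) f = trans (cong (_+ f (suc (suc n))) (Σ₁-suc n f))
                         (+-assoc (f 1) (Σ₁ n (f ∘ suc)) (f (suc (suc n))))

Σ₁-reverse : ∀ n f → Σ₁ n (λ j → f (suc n ∸ j)) ≡ Σ₁ n f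
Σ₁-reverse zero    f = refl
Σ₁-reverse (suc n) f = begin
  Σ₁ n (λ j → f (suc (suc n) ∸ j)) + f (suc (suc n) ∸ suc n)
    ≡⟨ cong₂ _+_ (Σ₁-cong n (λ j≤n → cong f (+-∸-assoc 1 (m≤n⇒m≤1+n j≤n))))
                 (cong f (m+n∸n≡m 1 n)) ⟩
  Σ₁ n (λ j → f (suc (suc n ∸ j))) + f 1
    ≡⟨ cong (_+ f 1) (Σ₁-reverse n (f ∘ suc)) ⟩
  Σ₁ n (f ∘ suc) + f 1
    ≡⟨ +-comm (Σ₁ n (f ∘ suc)) (f 1) ⟩
  f 1 + Σ₁ n (f ∘ suc)
    ≡⟨ Σ₁-suc n f ⟨
  Σ₁ (suc n) f ∎

geometric-sum : ∀ q n → (1ℚ - q) * Σ₁ n (q ^ᵠ_) ≡ q - q ^ᵠ suc n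
geometric-sum q zero    = solve 1 (λ q → (con 1ℚ :- q) :* con 0ℚ := q :- q :* con 1ℚ) refl q
geometric-sum q (suc n) = begin
  (1ℚ - q) * (S + q * p)              ≡⟨ *-distribˡ-+ (1ℚ - q) S (q * p) ⟩
  (1ℚ - q) * S + (1ℚ - q) * (q * p)   ≡⟨ cong (_+ (1ℚ - q) * (q * p)) (geometric-sum q n) ⟩
  q - q * p + (1ℚ - q) * (q * p)      ≡⟨ solve 2 (λ q p → q :- q :* p :+ (con 1ℚ :- q) :* (q :* p)
                                                        := q :- q :* (q :* p)) refl q p ⟩
  q - q * (q * p)                     ∎
  where
  S p : ℚ
  S = Σ₁ n (q ^ᵠ_)
  p = q ^ᵠ n

Σ₂-cong : ∀ {f g : Fin 2 → ℚ} → (∀ c → f c ≡ g c) → Σ₂ f ≡ Σ₂ g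
Σ₂-cong f≗g = cong₂ _+_ (f≗g zero) (f≗g 1ᶠ)

Σ₂-*val : ∀ (f : Fin 2 → ℚ) → Σ₂ (λ a → f a * val a) ≡ f 1ᶠ
Σ₂-*val f = trans (cong₂ _+_ (*-zeroʳ (f zero)) (*-identityʳ (f 1ᶠ))) (+-identityˡ (f 1ᶠ))

Σ₂Σ₂-*val*val : ∀ (g : Fin 2 → Fin 2 → ℚ) → Σ₂ (λ a → Σ₂ (λ b → g a b * (val a * val b))) ≡ g 1ᶠ 1ᶠ
Σ₂Σ₂-*val*val g =
  solve 4 (λ w x y z → w :* (con 0ℚ :* con 0ℚ) :+ x :* (con 0ℚ :* con 1ℚ)
                       :+ (y :* (con 1ℚ :* con 0ℚ) :+ z :* (con 1ℚ :* con 1ℚ)) := z)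
    refl (g zero zero) (g zero 1ᶠ) (g 1ᶠ zero) (g 1ᶠ 1ᶠ)

T-∘ : ∀ p q a b → Σ₂ (λ c → T p a c * T q c b) ≡ T (q * p) a b
T-∘ p q = compose
  where
  stay-stay : ½ * (1ℚ + p) * (½ * (1ℚ + q)) + ½ * (1ℚ - p) * (½ * (1ℚ - q)) ≡ ½ * (1ℚ + q * p)
  stay-stay = solve 2 (λ p q → con ½ :* (con 1ℚ :+ p) :* (con ½ :* (con 1ℚ :+ q))
                               :+ con ½ :* (con 1ℚ :- p) :* (con ½ :* (con 1ℚ :- q))
                               := con ½ :* (con 1ℚ :+ q :* p)) refl p q

  stay-move : ½ * (1ℚ + p) * (½ * (1ℚ - q)) + ½ * (1ℚ - p) * (½ * (1ℚ + q)) ≡ ½ * (1ℚ - q * p)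
  stay-move = solve 2 (λ p q → con ½ :* (con 1ℚ :+ p) :* (con ½ :* (con 1ℚ :- q))
                               :+ con ½ :* (con 1ℚ :- p) :* (con ½ :* (con 1ℚ :+ q))
                               := con ½ :* (con 1ℚ :- q :* p)) refl p q

  compose : ∀ a b → Σ₂ (λ c → T p a c * T q c b) ≡ T (q * p) a b
  compose zero       zero       = stay-stay
  compose zero       (suc zero) = stay-move
  compose (suc zero) zero       = trans (+-comm (T p 1ᶠ zero * T q zero zero) _) stay-move
  compose (suc zero) (suc zero) = trans (+-comm (T p 1ᶠ zero * T q zero 1ᶠ) _) stay-stay

Tⁿ≡T : ∀ μ n a b → Tⁿ μ n a b ≡ T (μ ^ᵠ n) a b
Tⁿ≡T μ zero    zero       zero       = refl
Tⁿ≡T μ zero    zero       (suc zero) = refl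
Tⁿ≡T μ zero    (suc zero) zero       = refl
Tⁿ≡T μ zero    (suc zero) (suc zero) = refl
Tⁿ≡T μ (suc n) a          b          =
  trans (Σ₂-cong (λ c → cong (_* T μ c b) (Tⁿ≡T μ n a c))) (T-∘ (μ ^ᵠ n) μ a b)

mean-closed : ∀ μ m → mean μ m ≡ ½ * (1ℚ - μ ^ᵠ m)
mean-closed μ m = trans (Σ₂-*val (law μ m)) (Tⁿ≡T μ m zero 1ᶠ)

cov-closed : ∀ μ {j m} → j ℕ.≤ m → cov μ j m ≡ ½ * ½ * (μ ^ᵠ (m ∸ j) - μ ^ᵠ m * μ ^ᵠ j)
cov-closed μ {j} {m} j≤m = begin
  cov μ j m
    ≡⟨ cong₂ _-_ (Σ₂Σ₂-*val*val (joint μ j m)) (cong₂ _*_ (mean-closed μ j) (mean-closed μ m)) ⟩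
  Tⁿ μ j zero 1ᶠ * Tⁿ μ (m ∸ j) 1ᶠ 1ᶠ - ½ * (1ℚ - a) * (½ * (1ℚ - μ ^ᵠ m))
    ≡⟨ cong (_- ½ * (1ℚ - a) * (½ * (1ℚ - μ ^ᵠ m)))
            (cong₂ _*_ (Tⁿ≡T μ j zero 1ᶠ) (Tⁿ≡T μ (m ∸ j) 1ᶠ 1ᶠ)) ⟩
  ½ * (1ℚ - a) * (½ * (1ℚ + b)) - ½ * (1ℚ - a) * (½ * (1ℚ - μ ^ᵠ m))
    ≡⟨ algebra (μ ^ᵠ m) (trans (cong (μ ^ᵠ_) (sym (m+[n∸m]≡n j≤m))) (^ᵠ-+ μ j (m ∸ j))) ⟩
  ½ * ½ * (b - μ ^ᵠ m * a) ∎
  where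
  a b : ℚ
  a = μ ^ᵠ j
  b = μ ^ᵠ (m ∸ j)
  algebra : ∀ c → c ≡ a * b →
    ½ * (1ℚ - a) * (½ * (1ℚ + b)) - ½ * (1ℚ - a) * (½ * (1ℚ - c)) ≡ ½ * ½ * (b - c * a)
  algebra _ refl =
    solve 2 (λ a b → con ½ :* (con 1ℚ :- a) :* (con ½ :* (con 1ℚ :+ b))
                     :- con ½ :* (con 1ℚ :- a) :* (con ½ :* (con 1ℚ :- a :* b))
                     := con ½ :* con ½ :* (b :- a :* b :* a)) refl a b

var-closed : ∀ μ m → var μ m ≡ ½ * ½ * (1ℚ - μ ^ᵠ m * μ ^ᵠ m)
var-closed μ m = trans (cov-closed μ (≤-refl {m}))
                       (cong (λ k → ½ * ½ * (μ ^ᵠ k - μ ^ᵠ m * μ ^ᵠ m)) (n∸n≡0 m))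

Σ₁-cov-closed : ∀ μ n → Σ₁ n (λ j → cov μ j (suc n))
                        ≡ ½ * ½ * (Σ₁ n (μ ^ᵠ_) - μ ^ᵠ suc n * Σ₁ n (μ ^ᵠ_))
Σ₁-cov-closed μ n = begin
  Σ₁ n (λ j → cov μ j (suc n))
    ≡⟨ Σ₁-cong n (λ j≤n → cov-closed μ (m≤n⇒m≤1+n j≤n)) ⟩
  Σ₁ n (λ j → ½ * ½ * (μ ^ᵠ (suc n ∸ j) - a * μ ^ᵠ j))
    ≡⟨ Σ₁-distribˡ (½ * ½) n _ ⟩
  ½ * ½ * Σ₁ n (λ j → μ ^ᵠ (suc n ∸ j) - a * μ ^ᵠ j)
    ≡⟨ cong (½ * ½ *_) (Σ₁-sub n _ _) ⟩
  ½ * ½ * (Σ₁ n (λ j → μ ^ᵠ (suc n ∸ j)) - Σ₁ n (λ j → a * μ ^ᵠ j))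
    ≡⟨ cong (½ * ½ *_) (cong₂ _-_ (Σ₁-reverse n (μ ^ᵠ_)) (Σ₁-distribˡ a n (μ ^ᵠ_))) ⟩
  ½ * ½ * (G - a * G) ∎
  where
  a G : ℚ
  a = μ ^ᵠ suc n
  G = Σ₁ n (μ ^ᵠ_)

dispNum-cross : ∀ μ n → dispNum μ (suc n) * ((1ℚ + 1ℚ) * (1ℚ - μ))
                        ≡ (1ℚ + μ) * (1ℚ - μ ^ᵠ suc n) * mean μ (suc n)
dispNum-cross μ n = begin
  dispNum μ (suc n) * W
    ≡⟨ cong (_* W) (cong₂ (λ v s → v + (1ℚ + 1ℚ) * s) (var-closed μ (suc n)) (Σ₁-cov-closed μ n)) ⟩
  (½ * ½ * (1ℚ - a * a) + (1ℚ + 1ℚ) * (½ * ½ * (G - a * G))) * W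
    ≡⟨ solve 3 (λ μ a G → (con ½ :* con ½ :* (con 1ℚ :- a :* a)
                            :+ (con 1ℚ :+ con 1ℚ) :* (con ½ :* con ½ :* (G :- a :* G)))
                           :* ((con 1ℚ :+ con 1ℚ) :* (con 1ℚ :- μ))
                         := con ½ :* (con 1ℚ :- a)
                            :* ((con 1ℚ :+ a) :* (con 1ℚ :- μ) :+ (con 1ℚ :+ con 1ℚ) :* ((con 1ℚ :- μ) :* G)))
               refl μ a G ⟩
  ½ * (1ℚ - a) * ((1ℚ + a) * (1ℚ - μ) + (1ℚ + 1ℚ) * ((1ℚ - μ) * G))
    ≡⟨ cong (λ t → ½ * (1ℚ - a) * ((1ℚ + a) * (1ℚ - μ) + (1ℚ + 1ℚ) * t)) (geometric-sum μ n) ⟩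
  ½ * (1ℚ - a) * ((1ℚ + a) * (1ℚ - μ) + (1ℚ + 1ℚ) * (μ - a))
    ≡⟨ solve 2 (λ μ a → con ½ :* (con 1ℚ :- a)
                          :* ((con 1ℚ :+ a) :* (con 1ℚ :- μ) :+ (con 1ℚ :+ con 1ℚ) :* (μ :- a))
                        := (con 1ℚ :+ μ) :* (con 1ℚ :- a) :* (con ½ :* (con 1ℚ :- a)))
               refl μ a ⟩
  (1ℚ + μ) * (1ℚ - a) * (½ * (1ℚ - a))
    ≡⟨ cong ((1ℚ + μ) * (1ℚ - a) *_) (mean-closed μ (suc n)) ⟨
  (1ℚ + μ) * (1ℚ - a) * mean μ (suc n) ∎
  where
  W a G : ℚ
  W = (1ℚ + 1ℚ) * (1ℚ - μ)
  a = μ ^ᵠ suc n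
  G = Σ₁ n (μ ^ᵠ_)

lemma7p6 : (μ : ℚ) → 0ℚ < μ → μ < 1ℚ → (m : ℕ) → m ≥ 1 →
    Σ (NonZero (mean μ m)) λ nzE →
    Σ (NonZero ((1ℚ + 1ℚ) * (1ℚ - μ))) λ nzD →
      dispersion μ m {{nzE}} ≡ Dinf μ {{nzD}} * (1ℚ - μ ^ᵠ m)
lemma7p6 μ 0<μ μ<1 (suc n) _ = nzE , nzD , (begin
  dispNum μ m ÷ mean μ m
    ≡⟨ ÷-cross (dispNum μ m) (mean μ m) ((1ℚ + μ) * (1ℚ - a)) W (dispNum-cross μ n) ⟩
  (1ℚ + μ) * (1ℚ - a) ÷ W
    ≡⟨ xy∙z≈xz∙y (1ℚ + μ) (1ℚ - a) _ ⟩
  Dinf μ * (1ℚ - a) ∎)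
  where
  m : ℕ
  m = suc n
  a W : ℚ
  a = μ ^ᵠ m
  W = (1ℚ + 1ℚ) * (1ℚ - μ)
  instance
    nzE : NonZero (mean μ m)
    nzE = subst NonZero (sym (mean-closed μ m)) (*[1-p]-nonZero ½ (^ᵠ-suc-<1 (<⇒≤ 0<μ) μ<1 n))
    nzD : NonZero W
    nzD = *[1-p]-nonZero (1ℚ + 1ℚ) μ<1
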